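{- Let $a\ge b\ge1$ be integers and $f(x,y,z)=xyz-ax-bz$. Then $V_f(2)\supseteq\mathbb{Z}_{>0}$ in each of the following cases: (a) $a+1$ or $b+1$ is not prime; (b) $a$ is divisible by $4$ and $b=1$. Moreover, $0\in V_f(2)$ whenever $(a,b)\notin\{(1,1),(2,1),(4,1)\}$.
   Context: For a polynomial $f\in\mathbb{Z}[x_1,\dots,x_n]$ and integer $r\ge1$, $V_f(r)=\{f(a_1,\dots,a_n):a_1,\dots,a_n\in\mathbb{Z}_{\ge r}\}\cap\mathbb{Z}_{\ge0}$. -}

module Defs where

open import Data.Nat as ℕ using (ℕ)
open import Data.Integer using (ℤ; +_; _*_; _-_; _≤_)
open import Data.Product using (Σ; ∃; _×_)
open import Relation.Binary.PropositionalEquality using (_≡_)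

f : ℕ → ℕ → ℤ → ℤ → ℤ → ℤ
f a b x y z = x * y * z - (+ a) * x - (+ b) * z

-- V_f(r) = { f(x,y,z) : x,y,z ∈ ℤ_{≥ r} } ∩ ℤ_{≥ 0}; membership of a natural n
InV : ℕ → ℕ → ℕ → ℕ → Set
InV a b r n = Σ ℤ λ x → Σ ℤ λ y → Σ ℤ λ z →
  (+ r ≤ x) × (+ r ≤ y) × (+ r ≤ z) × (f a b x y z ≡ + n)

{-# OPTIONS --safe #-}
-- Every case is settled by an explicit solution of x y z = n + a x + b z in naturals x, y, z ≥ 2.
-- If a + 1 = p q take (n + b q, p, q), since x (a + 1) = a x + x; symmetrically (p, q, n + a p)
-- if b + 1 = p q.  For a = 4k, b = 1, n ≥ 1 write n + 2k = 2^s m with m = 2c + 1 odd: if m > 1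
-- take (c + 1, 2, 2k + 2^s).  If m = 1 then 2^s > 2k ≥ 2^(r+1), where k = 2^r (2d + 1), so
-- 4·2^r divides 2^s and (2, 2^s / (4·2^r) + 3d + 2, 2^(r+1)) works.  For n = 0 take (b, 2, a)
-- if b ≥ 2; if b = 1 write a = 2^j (2c + 1) and take (2, c + 1, 2^(j+1)) when c ≥ 1, and
-- (3, 3, 3a/8) when a is a power of two other than 1, 2, 4.
module Submission where

open import Defs
open import Data.Nat using (ℕ; suc; _≤_; _*_)
open import Data.Nat.Primality using (Prime)
open import Data.Nat.Divisibility using (_∣_)
open import Data.Product using (_×_)
open import Data.Sum using (_⊎_)
open import Relation.Nullary using (¬_)
open import Relation.Binary.PropositionalEquality using (_≡_)

open import Data.Nat using (zero; _+_; _^_; _<_; _∸_; z≤n; s≤s; NonZero; >-nonZero)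
open import Data.Nat.Properties
  using (≤-trans; ≤-<-trans; +-mono-≤; *-monoʳ-≤; ^-monoʳ-≤; <⇒≱; ≰⇒>; <⇒≢; m<m+n; m<n+m; m≤m+n; m≤n+m;
         m≤m*n; m≤n*m; m^n>0; +-identityʳ; *-identityʳ; *-assoc; m+[n∸m]≡n; ^-distribˡ-+-*; suc-injective)
open import Data.Nat.Base using (nonTrivial⇒n>1)
open import Data.Nat.Induction using (<-rec)
open import Data.Nat.Primality using (¬prime⇒composite; composite)
open import Data.Nat.Divisibility using (divides)
open import Data.Nat.Tactic.RingSolver using (solve)
open import Data.Integer using (ℤ; +_; +≤+) renaming (_+_ to _+ℤ_; _*_ to _*ℤ_; _-_ to _-ℤ_)
open import Data.Integer.Properties using (pos-+; pos-*)
import Data.Integer.Tactic.RingSolver as ℤ-Solver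
open import Data.List using ([]; _∷_)
open import Data.Product using (∃; ∃₂; _,_)
open import Data.Sum using (inj₁; inj₂)
open import Function using (_∘_)
open import Relation.Nullary using (contradiction)
open import Relation.Binary.PropositionalEquality using (refl; sym; trans; cong; cong₂; subst; _≢_; module ≡-Reasoning)

open ≡-Reasoning

xyz≡n+ax+bz⇒f≡n : ∀ {a b} {n x y z : ℤ} → x *ℤ y *ℤ z ≡ n +ℤ + a *ℤ x +ℤ + b *ℤ z → f a b x y z ≡ n
xyz≡n+ax+bz⇒f≡n {a} {b} {n} {x} {y} {z} eq = begin
  x *ℤ y *ℤ z -ℤ + a *ℤ x -ℤ + b *ℤ z
    ≡⟨ cong (λ t → t -ℤ + a *ℤ x -ℤ + b *ℤ z) eq ⟩
  n +ℤ + a *ℤ x +ℤ + b *ℤ z -ℤ + a *ℤ x -ℤ + b *ℤ z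
    ≡⟨ cancel n (+ a *ℤ x) (+ b *ℤ z) ⟩
  n ∎
  where
  cancel : ∀ n p q → n +ℤ p +ℤ q -ℤ p -ℤ q ≡ n
  cancel = ℤ-Solver.solve-∀

xyz≡n+ax+bz⇒InV : ∀ a b n x y z → 2 ≤ x → 2 ≤ y → 2 ≤ z →
                  x * y * z ≡ n + a * x + b * z → InV a b 2 n
xyz≡n+ax+bz⇒InV a b n x y z 2≤x 2≤y 2≤z eq =
  + x , + y , + z , +≤+ 2≤x , +≤+ 2≤y , +≤+ 2≤z , xyz≡n+ax+bz⇒f≡n {a} {b} eqℤ
  where
  eqℤ : + x *ℤ + y *ℤ + z ≡ + n +ℤ + a *ℤ + x +ℤ + b *ℤ + z
  eqℤ = begin
    + x *ℤ + y *ℤ + z           ≡⟨ cong (_*ℤ + z) (pos-* x y) ⟨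
    + (x * y) *ℤ + z            ≡⟨ pos-* (x * y) z ⟨
    + (x * y * z)               ≡⟨ cong +_ eq ⟩
    + (n + a * x + b * z)       ≡⟨ pos-+ (n + a * x) (b * z) ⟩
    + (n + a * x) +ℤ + (b * z)  ≡⟨ cong₂ _+ℤ_ (pos-+ n (a * x)) (pos-* b z) ⟩
    + n +ℤ + (a * x) +ℤ + b *ℤ + z ≡⟨ cong (λ t → + n +ℤ t +ℤ + b *ℤ + z) (pos-* a x) ⟩
    + n +ℤ + a *ℤ + x +ℤ + b *ℤ + z ∎

even-or-odd : ∀ m → ∃ λ h → m ≡ 2 * h ⊎ m ≡ suc (2 * h)
even-or-odd zero = 0 , inj₁ refl
even-or-odd (suc m) with even-or-odd m
... | h , inj₁ m≡2h   = h , inj₂ (cong suc m≡2h)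
... | h , inj₂ m≡1+2h = suc h , inj₁ (cong suc (trans m≡1+2h (solve (h ∷ []))))

2-adic-decomposition : ∀ m → ∃₂ λ j c → suc m ≡ 2 ^ j * suc (2 * c)
2-adic-decomposition = <-rec _ decompose
  where
  decompose : ∀ m → (∀ {m′} → m′ < m → ∃₂ λ j c → suc m′ ≡ 2 ^ j * suc (2 * c)) →
              ∃₂ λ j c → suc m ≡ 2 ^ j * suc (2 * c)
  decompose m rec with even-or-odd (suc m)
  ... | c , inj₂ m+1≡odd = 0 , c , trans m+1≡odd (sym (+-identityʳ _))
  ... | zero , inj₁ ()
  ... | suc h , inj₁ m+1≡2[1+h] with rec h<m
    where
    h<m : h < m
    h<m = subst (h <_) (sym (suc-injective m+1≡2[1+h])) (m<m+n h (s≤s z≤n))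
  ... | j , c , 1+h≡2^j*odd = suc j , c , (begin
    suc m                          ≡⟨ m+1≡2[1+h] ⟩
    2 * suc h                      ≡⟨ cong (2 *_) 1+h≡2^j*odd ⟩
    2 * (2 ^ j * suc (2 * c))      ≡⟨ *-assoc 2 (2 ^ j) _ ⟨
    2 ^ suc j * suc (2 * c)        ∎)

^-cancelʳ-< : ∀ m .{{_ : NonZero m}} {j s} → m ^ j < m ^ s → j < s
^-cancelʳ-< m m^j<m^s = ≰⇒> λ s≤j → <⇒≱ m^j<m^s (^-monoʳ-≤ m s≤j)

^-split : ∀ m {j s} → j ≤ s → m ^ s ≡ m ^ j * m ^ (s ∸ j)
^-split m {j} {s} j≤s = trans (cong (m ^_) (sym (m+[n∸m]≡n j≤s))) (^-distribˡ-+-* m j (s ∸ j))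

¬prime⇒nontrivial-product : ∀ {m} → 2 ≤ m → ¬ Prime m →
                            ∃₂ λ p q → 2 ≤ p × 2 ≤ q × m ≡ p * q
¬prime⇒nontrivial-product {suc (suc m)} (s≤s (s≤s z≤n)) ¬prime with ¬prime⇒composite ¬prime
... | composite d<m (divides zero ())
... | composite {d} d<m (divides 1 m≡d) = contradiction (trans m≡d (+-identityʳ d)) (<⇒≢ d<m ∘ sym)
... | composite {d} _ (divides (suc (suc q)) m≡q*d) = suc (suc q) , d , s≤s (s≤s z≤n) , nonTrivial⇒n>1 d , m≡q*d

suc-a≡p*q⇒InV : ∀ a b n {p q} → 1 ≤ b → 1 ≤ n → 2 ≤ p → 2 ≤ q → suc a ≡ p * q → InV a b 2 n
suc-a≡p*q⇒InV a b n {p} {q} 1≤b 1≤n 2≤p 2≤q a+1≡pq =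
  xyz≡n+ax+bz⇒InV a b n (n + b * q) p q 2≤x 2≤p 2≤q (begin
    (n + b * q) * p * q    ≡⟨ *-assoc (n + b * q) p q ⟩
    (n + b * q) * (p * q)  ≡⟨ cong ((n + b * q) *_) a+1≡pq ⟨
    (n + b * q) * suc a    ≡⟨ solve (n ∷ b ∷ q ∷ a ∷ []) ⟩
    n + a * (n + b * q) + b * q ∎)
  where
  2≤x : 2 ≤ n + b * q
  2≤x = +-mono-≤ 1≤n (≤-trans (≤-trans (s≤s z≤n) 2≤q) (m≤n*m q b {{>-nonZero 1≤b}}))

suc-b≡p*q⇒InV : ∀ a b n {p q} → 1 ≤ a → 1 ≤ n → 2 ≤ p → 2 ≤ q → suc b ≡ p * q → InV a b 2 n
suc-b≡p*q⇒InV a b n {p} {q} 1≤a 1≤n 2≤p 2≤q b+1≡pq =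
  xyz≡n+ax+bz⇒InV a b n p q (n + a * p) 2≤p 2≤q 2≤z (begin
    p * q * (n + a * p)    ≡⟨ cong (_* (n + a * p)) b+1≡pq ⟨
    suc b * (n + a * p)    ≡⟨ solve (n ∷ a ∷ p ∷ b ∷ []) ⟩
    n + a * p + b * (n + a * p) ∎)
  where
  2≤z : 2 ≤ n + a * p
  2≤z = +-mono-≤ 1≤n (≤-trans 1≤a (m≤m*n a p {{>-nonZero (≤-trans (s≤s z≤n) 2≤p)}}))

n+2k≡t*odd⇒InV : ∀ k n {t c} → 1 ≤ k → 1 ≤ c → n + 2 * k ≡ t * suc (2 * c) → InV (k * 4) 1 2 n
n+2k≡t*odd⇒InV k n {t} {c} 1≤k 1≤c n+2k≡t*odd =
  xyz≡n+ax+bz⇒InV (k * 4) 1 n (suc c) 2 (2 * k + t) (s≤s 1≤c) (s≤s (s≤s z≤n)) 2≤z (begin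
    suc c * 2 * (2 * k + t)             ≡⟨ solve (c ∷ k ∷ t ∷ []) ⟩
    t * suc (2 * c) + k * 4 * suc c + t ≡⟨ cong (λ u → u + k * 4 * suc c + t) n+2k≡t*odd ⟨
    n + 2 * k + k * 4 * suc c + t       ≡⟨ solve (n ∷ k ∷ c ∷ t ∷ []) ⟩
    n + k * 4 * suc c + 1 * (2 * k + t) ∎)
  where
  2≤z : 2 ≤ 2 * k + t
  2≤z = ≤-trans (*-monoʳ-≤ 2 1≤k) (m≤m+n (2 * k) t)

n+2k≡4PE⇒InV : ∀ k n {P d E} → 1 ≤ P → k ≡ P * suc (2 * d) → n + 2 * k ≡ 4 * P * E → InV (k * 4) 1 2 n
n+2k≡4PE⇒InV k n {P} {d} {E} 1≤P k≡P*odd n+2k≡4PE =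
  xyz≡n+ax+bz⇒InV (k * 4) 1 n 2 (E + 3 * d + 2) (2 * P)
    (s≤s (s≤s z≤n)) (m≤n+m 2 (E + 3 * d)) (*-monoʳ-≤ 2 1≤P) (begin
    2 * (E + 3 * d + 2) * (2 * P)               ≡⟨ solve (E ∷ d ∷ P ∷ []) ⟩
    4 * P * E + 6 * (P * suc (2 * d)) + 2 * P  ≡⟨ cong₂ (λ u v → u + 6 * v + 2 * P) n+2k≡4PE k≡P*odd ⟨
    n + 2 * k + 6 * k + 2 * P                  ≡⟨ solve (n ∷ k ∷ P ∷ []) ⟩
    n + k * 4 * 2 + 1 * (2 * P)                ∎)

n+2k≡2^s⇒InV : ∀ k n {s} → 1 ≤ k → 1 ≤ n → n + 2 * k ≡ 2 ^ s → InV (k * 4) 1 2 n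
n+2k≡2^s⇒InV (suc k) n {s} _ 1≤n n+2k≡2^s
  with r , d , k+1≡2^r*odd ← 2-adic-decomposition k =
  n+2k≡4PE⇒InV (suc k) n {d = d} (m^n>0 2 r) k+1≡2^r*odd (begin
    n + 2 * suc k                       ≡⟨ n+2k≡2^s ⟩
    2 ^ s                               ≡⟨ ^-split 2 r+2≤s ⟩
    2 ^ (2 + r) * 2 ^ (s ∸ (2 + r))     ≡⟨ cong (_* 2 ^ (s ∸ (2 + r))) (^-distribˡ-+-* 2 2 r) ⟩
    4 * 2 ^ r * 2 ^ (s ∸ (2 + r))       ∎)
  where
  2^r≤k+1 : 2 ^ r ≤ suc k
  2^r≤k+1 = subst (2 ^ r ≤_) (sym k+1≡2^r*odd) (m≤m*n (2 ^ r) (suc (2 * d)))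
  2^[1+r]<2^s : 2 ^ suc r < 2 ^ s
  2^[1+r]<2^s = subst (2 ^ suc r <_) n+2k≡2^s
    (≤-<-trans (*-monoʳ-≤ 2 2^r≤k+1) (m<n+m (2 * suc k) 1≤n))
  r+2≤s : 2 + r ≤ s
  r+2≤s = ^-cancelʳ-< 2 2^[1+r]<2^s

4∣a∧b≡1⇒InV : ∀ k n → 1 ≤ k → 1 ≤ n → InV (k * 4) 1 2 n
4∣a∧b≡1⇒InV k (suc n) 1≤k 1≤n with 2-adic-decomposition (n + 2 * k)
... | s , zero , n+2k≡2^s*1 = n+2k≡2^s⇒InV k (suc n) {s} 1≤k 1≤n (trans n+2k≡2^s*1 (*-identityʳ (2 ^ s)))
... | s , suc c , n+2k≡2^s*odd = n+2k≡t*odd⇒InV k (suc n) {2 ^ s} {suc c} 1≤k (s≤s z≤n) n+2k≡2^s*odd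

2≤b≤a⇒0∈V : ∀ a b → 2 ≤ b → b ≤ a → InV a b 2 0
2≤b≤a⇒0∈V a b 2≤b b≤a =
  xyz≡n+ax+bz⇒InV a b 0 b 2 a 2≤b (s≤s (s≤s z≤n)) (≤-trans 2≤b b≤a) (solve (a ∷ b ∷ []))

a≡t*odd⇒0∈V : ∀ a {t c} → 1 ≤ t → 1 ≤ c → a ≡ t * suc (2 * c) → InV a 1 2 0
a≡t*odd⇒0∈V a {t} {c} 1≤t 1≤c a≡t*odd =
  xyz≡n+ax+bz⇒InV a 1 0 2 (suc c) (2 * t) (s≤s (s≤s z≤n)) (s≤s 1≤c) (*-monoʳ-≤ 2 1≤t) (begin
    2 * suc c * (2 * t)                 ≡⟨ solve (c ∷ t ∷ []) ⟩
    t * suc (2 * c) * 2 + 1 * (2 * t)  ≡⟨ cong (λ u → u * 2 + 1 * (2 * t)) a≡t*odd ⟨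
    a * 2 + 1 * (2 * t)                ∎)

a≡8i⇒0∈V : ∀ a {i} → 1 ≤ i → a ≡ 8 * i → InV a 1 2 0
a≡8i⇒0∈V a {i} 1≤i a≡8i =
  xyz≡n+ax+bz⇒InV a 1 0 3 3 (3 * i)
    (s≤s (s≤s z≤n)) (s≤s (s≤s z≤n)) (≤-trans (s≤s (s≤s z≤n)) (*-monoʳ-≤ 3 1≤i)) (begin
    3 * 3 * (3 * i)          ≡⟨ solve (i ∷ []) ⟩
    8 * i * 3 + 1 * (3 * i)  ≡⟨ cong (λ u → u * 3 + 1 * (3 * i)) a≡8i ⟨
    a * 3 + 1 * (3 * i)      ∎)

b≡1⇒0∈V : ∀ a → 1 ≤ a → a ≢ 1 → a ≢ 2 → a ≢ 4 → InV a 1 2 0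
b≡1⇒0∈V (suc a) (s≤s z≤n) a≢1 a≢2 a≢4 with 2-adic-decomposition a
... | j , suc c , a≡2^j*odd = a≡t*odd⇒0∈V (suc a) {2 ^ j} {suc c} (m^n>0 2 j) (s≤s z≤n) a≡2^j*odd
... | 0 , 0 , a≡1 = contradiction a≡1 a≢1
... | 1 , 0 , a≡2 = contradiction a≡2 a≢2
... | 2 , 0 , a≡4 = contradiction a≡4 a≢4
... | suc (suc (suc i)) , 0 , a≡2^[3+i] =
  a≡8i⇒0∈V (suc a) {2 ^ i} (m^n>0 2 i) (trans a≡2^[3+i] (trans (*-identityʳ _) (^-distribˡ-+-* 2 3 i)))

positives∈V : ∀ a b → 1 ≤ b → b ≤ a → ((¬ Prime (suc a) ⊎ ¬ Prime (suc b)) ⊎ (4 ∣ a × b ≡ 1)) →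
              ∀ n → 1 ≤ n → InV a b 2 n
positives∈V a b 1≤b b≤a (inj₁ (inj₁ ¬prime)) n 1≤n
  with p , q , 2≤p , 2≤q , a+1≡pq ← ¬prime⇒nontrivial-product (s≤s (≤-trans 1≤b b≤a)) ¬prime
  = suc-a≡p*q⇒InV a b n 1≤b 1≤n 2≤p 2≤q a+1≡pq
positives∈V a b 1≤b b≤a (inj₁ (inj₂ ¬prime)) n 1≤n
  with p , q , 2≤p , 2≤q , b+1≡pq ← ¬prime⇒nontrivial-product (s≤s 1≤b) ¬prime
  = suc-b≡p*q⇒InV a b n (≤-trans 1≤b b≤a) 1≤n 2≤p 2≤q b+1≡pq
positives∈V .0 1 _ () (inj₂ (divides zero refl , refl))
positives∈V .(suc k * 4) 1 _ _ (inj₂ (divides (suc k) refl , refl)) n 1≤n =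
  4∣a∧b≡1⇒InV (suc k) n (s≤s z≤n) 1≤n

0∈V : ∀ a b → 1 ≤ b → b ≤ a → ¬ (a ≡ 1 × b ≡ 1) → ¬ (a ≡ 2 × b ≡ 1) → ¬ (a ≡ 4 × b ≡ 1) → InV a b 2 0
0∈V a 1 _ 1≤a ¬a≡1 ¬a≡2 ¬a≡4 = b≡1⇒0∈V a 1≤a (¬a≡1 ∘ (_, refl)) (¬a≡2 ∘ (_, refl)) (¬a≡4 ∘ (_, refl))
0∈V a (suc (suc b)) _ b≤a _ _ _ = 2≤b≤a⇒0∈V a (suc (suc b)) (s≤s (s≤s z≤n)) b≤a

proposition6p5 : (a b : ℕ) → 1 ≤ b → b ≤ a →
    (((¬ Prime (suc a) ⊎ ¬ Prime (suc b)) ⊎ (4 ∣ a × b ≡ 1)) →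
      (n : ℕ) → 1 ≤ n → InV a b 2 n)
    × (¬ (a ≡ 1 × b ≡ 1) → ¬ (a ≡ 2 × b ≡ 1) → ¬ (a ≡ 4 × b ≡ 1) → InV a b 2 0)
proposition6p5 a b 1≤b b≤a = positives∈V a b 1≤b b≤a , 0∈V a b 1≤b b≤a
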